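{- For each prime $p$, there are at most two extreme symmetric sequences of length $3$ whose smallest element is $p$, and at most one extreme symmetric sequence of length $4$ whose smallest element is $p$. Moreover, there are no extreme symmetric sequences of length greater than $4$.
   Context: Two distinct primes $p$ and $q$ form a symmetric pair if $\gcd(p-1, q-1) = |p-q|$ (an equivalent form of the definition via lattice points in the rectangle with corner $(p/2,q/2)$). A symmetric sequence is a finite set of primes in which any two distinct primes form a symmetric pair; its length is its number of elements. A symmetric sequence is extreme if, writing $p$ for its smallest element, its largest element is $2p-1$. -}

module Defs where

open import Data.Nat using (ℕ; _∸_; _*_; _≤_; ∣_-_∣)
open import Data.Nat.GCD using (gcd)
open import Data.Nat.Primality using (Prime)
open import Data.List using (List; length)
open import Data.List.Membership.Propositional using (_∈_)
open import Data.List.Relation.Unary.All using (All)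
open import Data.List.Relation.Unary.Unique.Propositional using (Unique)
open import Data.Product using (_×_)
open import Relation.Binary.PropositionalEquality using (_≡_; _≢_)
open import Function.Bundles using (_⇔_)

SymmetricPair : ℕ → ℕ → Set
SymmetricPair p q = Prime p × Prime q × p ≢ q × gcd (p ∸ 1) (q ∸ 1) ≡ ∣ p - q ∣

SymmetricSequence : List ℕ → Set
SymmetricSequence S =
  Unique S × All Prime S ×
  (∀ {a b} → a ∈ S → b ∈ S → a ≢ b → SymmetricPair a b)

ExtremeWithMin : ℕ → List ℕ → Set
ExtremeWithMin p S =
  SymmetricSequence S ×
  p ∈ S × All (p ≤_) S ×
  (2 * p ∸ 1) ∈ S × All (_≤ 2 * p ∸ 1) S

SameSet : List ℕ → List ℕ → Set
SameSet S T = ∀ x → (x ∈ S) ⇔ (x ∈ T)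

-- Let p < x < P = 2p - 1 be the smallest, a middle and the largest element of an
-- extreme symmetric sequence, and write d = x - p, e = P - x, so that p - 1 = d + e.
-- The pair (p, x) gives d ∣ p - 1, hence d ∣ e; the pair (x, P) gives e ∣ x - 1 = e + 2d,
-- hence e ∣ 2d.  So e = d or e = 2d, i.e. x = p + (p - 1)/2 or x = p + (p - 1)/3:
-- every extreme sequence lies inside {p, 2p - 1, p + (p - 1)/2, p + (p - 1)/3}.
-- Counting elements of duplicate-free lists inside this four-element list gives all
-- three claims.
module Submission where

open import Defs
open import Data.Nat using (ℕ; NonZero; zero; suc; _+_; _*_; _∸_; _/_; _≤_; _<_; _>_; z≤n; s≤s; s≤s⁻¹; ∣_-_∣; _≟_)
open import Data.Nat.Properties using (*-zeroʳ; *-identityˡ; *-comm; +-identityʳ; +-suc; +-cancelˡ-<; m≤n⇒∃[o]m+o≡n; m+[n∸m]≡n; [m+n]∸[m+o]≡n∸o; ∣m-m+n∣≡n; m≤n⇒∣m-n∣≡n∸m; n>0⇒n≢0; m<n⇒0<n∸m; <⇒≤; <⇒≢; <⇒≱; ≤∧≢⇒<; <-≤-trans; ≤-reflexive; n<1+n; module ≤-Reasoning)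
open import Data.Nat.DivMod using (m*n/n≡m)
open import Data.Nat.Divisibility using (_∣_; divides-refl; ∣m+n∣m⇒∣n; ∣-refl; ∣⇒≤; *-cancelʳ-∣)
open import Data.Nat.GCD using (gcd; gcd[m,n]∣m)
open import Data.Nat.Primality using (Prime)
open import Data.Nat.Tactic.RingSolver using (solve-∀)
open import Data.List using (List; []; _∷_; _++_; [_]; length)
open import Data.List.Properties using (length-removeAt′)
open import Data.List.Membership.Propositional using (_∈_; _∉_; find)
open import Data.List.Membership.Propositional.Properties using (∈-++⁺ʳ; ∈-++⁻)
import Data.List.Membership.DecPropositional as DecMembership
open import Data.List.Relation.Unary.All using ([]; _∷_; all?; lookup)
open import Data.List.Relation.Unary.All.Properties using (¬All⇒Any¬)
open import Data.List.Relation.Unary.Any using (here; there; index; _─_)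
open import Data.List.Relation.Unary.Unique.Propositional using (Unique; []; _∷_)
open import Data.List.Relation.Binary.Subset.Propositional using (_⊆_)
open import Data.Product using (_×_; _,_; ∃-syntax)
open import Data.Sum using (_⊎_; inj₁; inj₂)
open import Function using (_∘_)
open import Function.Bundles using (mk⇔)
import Function.Properties.Equivalence as ⇔
open import Relation.Binary.Definitions using (DecidableEquality)
open import Relation.Binary.PropositionalEquality using (_≡_; _≢_; refl; sym; trans; cong; subst; module ≡-Reasoning)
open import Relation.Nullary using (¬_; yes; no; contradiction)

module _ {a} {A : Set a} where

  ∈-─ : ∀ {x y} {xs : List A} (x∈xs : x ∈ xs) → y ∈ xs → x ≢ y → y ∈ (xs ─ x∈xs)
  ∈-─ (here refl) (here refl) x≢y = contradiction refl x≢y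
  ∈-─ (here _)    (there y∈)  _   = y∈
  ∈-─ (there _)   (here refl) _   = here refl
  ∈-─ (there x∈)  (there y∈)  x≢y = there (∈-─ x∈ y∈ x≢y)

  unique-⊆⇒length≤ : ∀ {xs ys : List A} → Unique xs → xs ⊆ ys → length xs ≤ length ys
  unique-⊆⇒length≤ []                         _     = z≤n
  unique-⊆⇒length≤ {x ∷ xs} {ys} (x∉xs ∷ u) xs⊆ys = begin
    suc (length xs)          ≤⟨ s≤s (unique-⊆⇒length≤ u xs⊆ys─x) ⟩
    suc (length (ys ─ x∈ys)) ≡⟨ sym (length-removeAt′ ys (index x∈ys)) ⟩
    length ys                ∎
    where
    open ≤-Reasoning
    x∈ys : x ∈ ys
    x∈ys = xs⊆ys (here refl)
    xs⊆ys─x : xs ⊆ (ys ─ x∈ys)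
    xs⊆ys─x y∈xs = ∈-─ x∈ys (xs⊆ys (there y∈xs)) (lookup x∉xs y∈xs)

module _ {a} {A : Set a} (_≟_ : DecidableEquality A) where

  open DecMembership _≟_ using (_∈?_)

  length<⇒∃∉ : ∀ {xs ys : List A} → Unique xs → length ys < length xs →
               ∃[ x ] x ∈ xs × x ∉ ys
  length<⇒∃∉ {xs} {ys} u ys<xs with all? (_∈? ys) xs
  ... | yes xs⊆ys = contradiction (unique-⊆⇒length≤ u (lookup xs⊆ys)) (<⇒≱ ys<xs)
  ... | no  xs⊈ys = find (¬All⇒Any¬ (_∈? ys) xs xs⊈ys)

  unique-⊆-length≥⇒⊇ : ∀ {xs ys : List A} → Unique xs → xs ⊆ ys → length ys ≤ length xs →
                       ys ⊆ xs
  unique-⊆-length≥⇒⊇ {xs} {ys} u xs⊆ys ys≤xs {y} y∈ys with y ∈? xs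
  ... | yes y∈xs = y∈xs
  ... | no  y∉xs = contradiction ys≤xs (<⇒≱ (begin-strict
    length xs                 ≤⟨ unique-⊆⇒length≤ u xs⊆ys─y ⟩
    length (ys ─ y∈ys)        <⟨ n<1+n _ ⟩
    suc (length (ys ─ y∈ys))  ≡⟨ sym (length-removeAt′ ys (index y∈ys)) ⟩
    length ys                 ∎))
    where
    open ≤-Reasoning
    xs⊆ys─y : xs ⊆ (ys ─ y∈ys)
    xs⊆ys─y x∈xs = ∈-─ y∈ys (xs⊆ys x∈xs) λ { refl → y∉xs x∈xs }

-- Floor division: for p of the wrong residue the entry is junk, which is harmless
-- because this list is only used as an upper bound.
middles : ℕ → List ℕ
middles p = p + (p ∸ 1) / 2 ∷ p + (p ∸ 1) / 3 ∷ []

multiple-dividing-double : ∀ {d e} → d ∣ e → e ∣ 2 * d → e ≢ 0 → e ≡ d ⊎ e ≡ 2 * d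
multiple-dividing-double {zero}      (divides-refl k) _      e≢0 = contradiction (*-zeroʳ k) e≢0
multiple-dividing-double {d@(suc _)} (divides-refl k) k*d∣2d e≢0 =
  from-k k (*-cancelʳ-∣ d k*d∣2d) e≢0
  where
  from-k : ∀ k → k ∣ 2 → k * d ≢ 0 → k * d ≡ d ⊎ k * d ≡ 2 * d
  from-k 0                   _   0≢0 = contradiction refl 0≢0
  from-k 1                   _   _   = inj₁ (*-identityˡ d)
  from-k 2                   _   _   = inj₂ refl
  from-k (suc (suc (suc k))) k∣2 _   = contradiction (∣⇒≤ k∣2) λ { (s≤s (s≤s ())) }

gap-ratio : ∀ {n d e} → n ≡ d + e → d ∣ n → e ∣ n + d → e ≢ 0 → e ≡ d ⊎ e ≡ 2 * d
gap-ratio {d = d} {e} refl d∣n e∣n+d = multiple-dividing-double d∣e e∣2d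
  where
  d∣e : d ∣ e
  d∣e = ∣m+n∣m⇒∣n d∣n ∣-refl
  n+d≡e+2d : ∀ a b → a + b + a ≡ b + 2 * a
  n+d≡e+2d = solve-∀
  e∣2d : e ∣ 2 * d
  e∣2d = ∣m+n∣m⇒∣n (subst (e ∣_) (n+d≡e+2d d e) e∣n+d) ∣-refl

m≡n*o⇒m/n≡o : ∀ {m o} n .{{_ : NonZero n}} → m ≡ n * o → m / n ≡ o
m≡n*o⇒m/n≡o {o = o} n refl = trans (cong (_/ n) (*-comm n o)) (m*n/n≡m o n)

gaps⇒∈middles : ∀ {n d e} → n ≡ d + e → d ∣ n → e ∣ n + d → e ≢ 0 → suc n + d ∈ middles (suc n)
gaps⇒∈middles {n} {d} n≡d+e d∣n e∣n+d e≢0 with gap-ratio n≡d+e d∣n e∣n+d e≢0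
... | inj₁ refl = here (cong (suc n +_) (sym (m≡n*o⇒m/n≡o 2 n≡2d)))
  where
  n≡2d : n ≡ 2 * d
  n≡2d = trans n≡d+e (cong (d +_) (sym (+-identityʳ d)))
... | inj₂ refl = there (here (cong (suc n +_) (sym (m≡n*o⇒m/n≡o 3 n≡d+e))))

2*[1+n]∸1≡1+[n+n] : ∀ n → 2 * suc n ∸ 1 ≡ suc (n + n)
2*[1+n]∸1≡1+[n+n] n = trans (+-suc n (n + 0)) (cong (λ m → suc (n + m)) (+-identityʳ n))

middle∈middles : ∀ {p x} → p ≤ x → x < 2 * p ∸ 1 →
                 gcd (p ∸ 1) (x ∸ 1) ≡ ∣ p - x ∣ →
                 gcd (x ∸ 1) (2 * p ∸ 1 ∸ 1) ≡ ∣ x - 2 * p ∸ 1 ∣ →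
                 x ∈ middles p
middle∈middles {zero}  _   ()
middle∈middles {suc n} p≤x x<P g₁ g₂ with d , refl ← m≤n⇒∃[o]m+o≡n p≤x =
  gaps⇒∈middles (sym (m+[n∸m]≡n (<⇒≤ d<n))) d∣n e∣n+d (n>0⇒n≢0 (m<n⇒0<n∸m d<n))
  where
  open ≡-Reasoning
  d<n : d < n
  d<n = +-cancelˡ-< n d n (s≤s⁻¹ (subst (suc n + d <_) (2*[1+n]∸1≡1+[n+n] n) x<P))
  d∣n : d ∣ n
  d∣n = subst (_∣ n) (trans g₁ (∣m-m+n∣≡n (suc n) d)) (gcd[m,n]∣m n (n + d))
  gap₂ : ∣ suc n + d - 2 * suc n ∸ 1 ∣ ≡ n ∸ d
  gap₂ = begin
    ∣ suc n + d - 2 * suc n ∸ 1 ∣  ≡⟨ m≤n⇒∣m-n∣≡n∸m (<⇒≤ x<P) ⟩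
    2 * suc n ∸ 1 ∸ (suc n + d)    ≡⟨ cong (_∸ (suc n + d)) (2*[1+n]∸1≡1+[n+n] n) ⟩
    n + n ∸ (n + d)                ≡⟨ [m+n]∸[m+o]≡n∸o n n d ⟩
    n ∸ d                          ∎
  e∣n+d : n ∸ d ∣ n + d
  e∣n+d = subst (_∣ n + d) (trans g₂ gap₂) (gcd[m,n]∣m (n + d) _)

ends : ℕ → List ℕ
ends p = p ∷ 2 * p ∸ 1 ∷ []

candidates : ℕ → List ℕ
candidates p = ends p ++ middles p

SameSet-sym : ∀ {S T} → SameSet S T → SameSet T S
SameSet-sym S≈T x = ⇔.sym (S≈T x)

SameSet-trans : ∀ {S T U} → SameSet S T → SameSet T U → SameSet S U
SameSet-trans S≈T T≈U x = ⇔.trans (S≈T x) (T≈U x)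

⊆-antisym⇒SameSet : ∀ {S T} → S ⊆ T → T ⊆ S → SameSet S T
⊆-antisym⇒SameSet S⊆T T⊆S _ = mk⇔ S⊆T T⊆S

pigeonhole-pair : ∀ {a b x y z : ℕ} → x ∈ a ∷ b ∷ [] → y ∈ a ∷ b ∷ [] → z ∈ a ∷ b ∷ [] →
                  x ≡ y ⊎ x ≡ z ⊎ y ≡ z
pigeonhole-pair (here refl)         (here refl)         _                   = inj₁ refl
pigeonhole-pair (there (here refl)) (there (here refl)) _                   = inj₁ refl
pigeonhole-pair (here refl)         (there (here refl)) (here refl)         = inj₂ (inj₁ refl)
pigeonhole-pair (here refl)         (there (here refl)) (there (here refl)) = inj₂ (inj₂ refl)
pigeonhole-pair (there (here refl)) (here refl)         (here refl)         = inj₂ (inj₂ refl)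
pigeonhole-pair (there (here refl)) (here refl)         (there (here refl)) = inj₂ (inj₁ refl)

extreme⊆candidates : ∀ {p S} → ExtremeWithMin p S → S ⊆ candidates p
extreme⊆candidates {p} ((_ , _ , pair) , p∈S , p≤S , P∈S , S≤P) {x} x∈S
  with x ≟ p | x ≟ 2 * p ∸ 1
... | yes refl | _        = here refl
... | no _     | yes refl = there (here refl)
... | no x≢p   | no x≢P   with _ , _ , _ , g₁ ← pair p∈S x∈S (x≢p ∘ sym)
                           with _ , _ , _ , g₂ ← pair x∈S P∈S x≢P =
  ∈-++⁺ʳ (ends p) (middle∈middles (lookup p≤S x∈S) (≤∧≢⇒< (lookup S≤P x∈S) x≢P) g₁ g₂)

extreme-length≤4 : ∀ {p S} → ExtremeWithMin p S → length S ≤ 4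
extreme-length≤4 E@((unique , _) , _) = unique-⊆⇒length≤ unique (extreme⊆candidates E)

extreme-length≡4⇒SameSet : ∀ {p S} → ExtremeWithMin p S → length S ≡ 4 → SameSet S (candidates p)
extreme-length≡4⇒SameSet {p} {S} E@((unique , _) , _) len = ⊆-antisym⇒SameSet S⊆C
  (unique-⊆-length≥⇒⊇ _≟_ unique S⊆C (≤-reflexive (sym len)))
  where
  S⊆C : S ⊆ candidates p
  S⊆C = extreme⊆candidates E

extreme-length≡3⇒SameSet : ∀ {p S} → ExtremeWithMin p S → length S ≡ 3 →
                  ∃[ x ] x ∈ middles p × SameSet S (ends p ++ [ x ])
extreme-length≡3⇒SameSet {p} {S} E@((unique , _) , p∈S , p≤S , P∈S , S≤P) len
  with x , x∈S , x∉ends ← length<⇒∃∉ _≟_ unique (subst (2 <_) (sym len) (n<1+n 2)) =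
  x , x∈middles , ⊆-antisym⇒SameSet (unique-⊆-length≥⇒⊇ _≟_ unique-L L⊆S (≤-reflexive len)) L⊆S
  where
  x≢p : x ≢ p
  x≢p = x∉ends ∘ here
  x≢P : x ≢ 2 * p ∸ 1
  x≢P = x∉ends ∘ there ∘ here
  x∈middles : x ∈ middles p
  x∈middles with ∈-++⁻ (ends p) (extreme⊆candidates E x∈S)
  ... | inj₁ x∈ends    = contradiction x∈ends x∉ends
  ... | inj₂ x∈middles = x∈middles
  p<P : p < 2 * p ∸ 1
  p<P = <-≤-trans (≤∧≢⇒< (lookup p≤S x∈S) (x≢p ∘ sym)) (lookup S≤P x∈S)
  unique-L : Unique (ends p ++ [ x ])
  unique-L = (<⇒≢ p<P ∷ (x≢p ∘ sym) ∷ []) ∷ ((x≢P ∘ sym) ∷ []) ∷ [] ∷ []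
  L⊆S : ends p ++ [ x ] ⊆ S
  L⊆S (here refl)                 = p∈S
  L⊆S (there (here refl))         = P∈S
  L⊆S (there (there (here refl))) = x∈S

at-most-two-extreme-triples : ∀ {p S₁ S₂ S₃} →
  ExtremeWithMin p S₁ → length S₁ ≡ 3 →
  ExtremeWithMin p S₂ → length S₂ ≡ 3 →
  ExtremeWithMin p S₃ → length S₃ ≡ 3 →
  SameSet S₁ S₂ ⊎ SameSet S₁ S₃ ⊎ SameSet S₂ S₃
at-most-two-extreme-triples E₁ len₁ E₂ len₂ E₃ len₃
  with x₁ , x₁∈M , S₁≈ ← extreme-length≡3⇒SameSet E₁ len₁
     | x₂ , x₂∈M , S₂≈ ← extreme-length≡3⇒SameSet E₂ len₂
     | x₃ , x₃∈M , S₃≈ ← extreme-length≡3⇒SameSet E₃ len₃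
  with pigeonhole-pair x₁∈M x₂∈M x₃∈M
... | inj₁ refl        = inj₁ (SameSet-trans S₁≈ (SameSet-sym S₂≈))
... | inj₂ (inj₁ refl) = inj₂ (inj₁ (SameSet-trans S₁≈ (SameSet-sym S₃≈)))
... | inj₂ (inj₂ refl) = inj₂ (inj₂ (SameSet-trans S₂≈ (SameSet-sym S₃≈)))

unique-extreme-quadruple : ∀ {p S T} →
  ExtremeWithMin p S → length S ≡ 4 →
  ExtremeWithMin p T → length T ≡ 4 →
  SameSet S T
unique-extreme-quadruple E lenS F lenT =
  SameSet-trans (extreme-length≡4⇒SameSet E lenS) (SameSet-sym (extreme-length≡4⇒SameSet F lenT))

corollary2 :
    (∀ p → Prime p → (S₁ S₂ S₃ : List ℕ) →
      ExtremeWithMin p S₁ → length S₁ ≡ 3 →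
      ExtremeWithMin p S₂ → length S₂ ≡ 3 →
      ExtremeWithMin p S₃ → length S₃ ≡ 3 →
      SameSet S₁ S₂ ⊎ SameSet S₁ S₃ ⊎ SameSet S₂ S₃)
    × (∀ p → Prime p → (S T : List ℕ) →
      ExtremeWithMin p S → length S ≡ 4 →
      ExtremeWithMin p T → length T ≡ 4 →
      SameSet S T)
    × (∀ p (S : List ℕ) → ExtremeWithMin p S → ¬ (length S > 4))
corollary2 =
  (λ _ _ _ _ _ → at-most-two-extreme-triples) ,
  (λ _ _ _ _ → unique-extreme-quadruple) ,
  (λ _ _ E S>4 → <⇒≱ S>4 (extreme-length≤4 E))
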